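{- Let $b,n$ be natural numbers with $1<n<b$, let $M$ be the $(n,b)$-mother graph, let $\{C_0,C_1,\ldots,C_m\}$ be the collection of (directed) cycles of $M$, and for each $j$ let $\Delta_j$ be the multi-image of $C_j$ in the $(n,b)$-Hoey-Sloane multigraph $\Delta$. Let $I$ be a multiset whose support is a subset of $\{0,1,\ldots,m\}$. Then the multiset union $C_I=\biguplus_{j\in I}C_j$ can be ordered into an $(n,b)$-permutiple string if and only if the multigraph union $\Delta_I=\biguplus_{j\in I}\Delta_j$ contains the state $0$, is strongly connected, and has equal indegree and outdegree at each vertex.
   Context: Base-$b$ digits are the integers $0,\ldots,b-1$, and $(d_k,\ldots,d_0)_b=\sum_{j=0}^k d_jb^j$. For integer $x$, $\lambda(x)$ is the least non-negative residue of $x$ mod $b$. The $(n,b)$-mother graph $M$ is the directed graph with vertex set the base-$b$ digits and edges the ordered pairs $(d_1,d_2)$ of digits with $\lambda(d_1+(b-n)d_2)\leq n-1$. A cycle of $M$ is a directed cycle (loops allowed), regarded as its set of edges. For every edge $(d_1,d_2)$ of $M$ there is a unique pair of integers $(c_1,c_2)$ with $0\le c_1,c_2\le n-1$ and $bc_2-c_1=nd_2-d_1$; we say $(d_1,d_2)$ induces the transition from state $c_1$ to state $c_2$. The $(n,b)$-Hoey-Sloane multigraph $\Delta$ has vertex set (states) $\{0,1,\ldots,n-1\}$ and, for each edge $(d_1,d_2)$ of $M$, one directed multiedge from $c_1$ to $c_2$ (the transition it induces) labeled $(d_1,d_2)$. For a cycle $C_j$ of $M$, its multi-image $\Delta_j$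 is the sub-multigraph of $\Delta$ consisting of the multiedges whose labels lie in $C_j$, with vertex set the states incident to these multiedges. For a multiset $I$ of indices, $C_I=\biguplus_{j\in I}C_j$ is the multiset union (each $C_j$ counted with its multiplicity in $I$), and $\Delta_I=\biguplus_{j\in I}\Delta_j$ is the multigraph union in which multiedges are counted with multiplicity (vertices are the states incident to its multiedges). The language $L$ consists of the finite strings $s=(d_0,\hat d_0)(d_1,\hat d_1)\cdots(d_k,\hat d_k)$ of edges of $M$ for which there are states $c_0=0,c_1,\ldots,c_{k+1}=0$ in $\{0,\ldots,n-1\}$ with $(d_j,\hat d_j)$ inducing the transition from $c_j$ to $c_{j+1}$ for every $j$ (i.e. $bc_{j+1}-c_j=n\hat d_j-d_j$). An $(n,b)$-permutiple string is a member $s$ of $L$ for which there is a permutation $\sigma$ of $\{0,\ldots,k\}$ with $\hat d_j=d_{\sigma(j)}$ for all $j$, so that $(d_k,\ldots,d_0)_b=n\,(d_{\sigma(k)},\ldots,d_{\sigma(0)})_b$. "$C_I$ can be ordered into a permutiple string" means the elements of the multiset $C_I$, each used exactly as many times as its multiplicity, can be arranged in a sequence forming a permutiple string. -}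

module Defs where

open import Data.Nat using (ℕ; zero; suc; _+_; _*_; _∸_; _<_; NonZero)
open import Data.Nat.DivMod using (_%_)
open import Data.Nat.Properties using (_≟_)
open import Data.Fin using (Fin; toℕ)
open import Data.Fin.Properties using (any?)
open import Data.Fin.Permutation using (Permutation′; _⟨$⟩ʳ_)
open import Data.List using (List; []; _∷_; _++_; [_]; zip; concatMap; length; filter; lookup)
open import Data.List.Membership.Propositional using (_∈_)
open import Data.List.Relation.Unary.All using (All)
open import Data.List.Relation.Unary.Unique.Propositional using (Unique)
open import Data.List.Relation.Binary.Permutation.Propositional using (_↭_)
open import Data.Product using (_×_; _,_; proj₁; proj₂; ∃; ∃-syntax; Σ-syntax)
open import Data.Sum using (_⊎_)
open import Relation.Binary.PropositionalEquality using (_≡_)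
open import Relation.Binary.Construct.Closure.ReflexiveTransitive using (Star)
open import Relation.Nullary using (Dec)
open import Data.Empty using (⊥)

Pair : Set
Pair = ℕ × ℕ

-- Edges of a directed cycle given by its cyclic vertex sequence v0 … v(k-1):
-- (v0,v1), …, (v(k-2),v(k-1)), (v(k-1),v0).   (A loop is the case k = 1.)
cycleEdges : List ℕ → List Pair
cycleEdges []       = []
cycleEdges (v ∷ vs) = zip (v ∷ vs) (vs ++ [ v ])

module _ (b n : ℕ) .{{_ : NonZero b}} where

  Digit : ℕ → Set
  Digit d = d < b

  lam : ℕ → ℕ
  lam x = x % b

  -- (d1,d2) is an edge of the (n,b)-mother graph: λ(d1 + (b-n) d2) ≤ n-1
  -- (here b - n is a natural number since n < b in the theorem).
  IsEdgeM : Pair → Set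
  IsEdgeM (d₁ , d₂) = Digit d₁ × Digit d₂ × lam (d₁ + (b ∸ n) * d₂) < n

  IsCycleM : List ℕ → Set
  IsCycleM []       = ⊥
  IsCycleM (v ∷ vs) = Unique (v ∷ vs) × All Digit (v ∷ vs) × All IsEdgeM (cycleEdges (v ∷ vs))

  -- (d1,d2) induces the transition c1 → c2 (states in {0,…,n-1}):
  -- b c2 - c1 = n d2 - d1, written without subtraction.
  Induces : Pair → Fin n → Fin n → Set
  Induces (d₁ , d₂) c₁ c₂ = b * toℕ c₂ + d₁ ≡ n * d₂ + toℕ c₁

  Induces? : ∀ e c₁ c₂ → Dec (Induces e c₁ c₂)
  Induces? (d₁ , d₂) c₁ c₂ = (b * toℕ c₂ + d₁) ≟ (n * d₂ + toℕ c₁)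

  -- Multigraph union Δ_I determined by the multiset of labels CI (a list of edges of M):
  -- one multiedge per element of CI, from the state c1 to c2 that it induces.

  Step : List Pair → Fin n → Fin n → Set
  Step CI c₁ c₂ = ∃[ e ] (e ∈ CI × Induces e c₁ c₂)

  IsVertex : List Pair → Fin n → Set
  IsVertex CI c = ∃[ c' ] (Step CI c c' ⊎ Step CI c' c)

  ContainsState0 : List Pair → Set
  ContainsState0 CI = ∃[ c ] (toℕ c ≡ 0 × IsVertex CI c)

  StronglyConnected : List Pair → Set
  StronglyConnected CI = ∀ u v → IsVertex CI u → IsVertex CI v → Star (Step CI) u v

  outdeg : List Pair → Fin n → ℕ
  outdeg CI c = length (filter (λ e → any? (λ c₂ → Induces? e c c₂)) CI)

  indeg : List Pair → Fin n → ℕ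
  indeg CI c = length (filter (λ e → any? (λ c₁ → Induces? e c₁ c)) CI)

  Balanced : List Pair → Set
  Balanced CI = ∀ c → IsVertex CI c → indeg CI c ≡ outdeg CI c

  Run : Fin n → List Pair → Set
  Run c []      = toℕ c ≡ 0
  Run c (e ∷ s) = ∃[ c' ] (Induces e c c' × Run c' s)

  InL : List Pair → Set
  InL []      = ⊥
  InL (e ∷ s) = All IsEdgeM (e ∷ s) × ∃[ c₀ ] (toℕ c₀ ≡ 0 × Run c₀ (e ∷ s))

  -- (n,b)-permutiple string: in L, and hat d_j = d_{σ(j)} for a permutation σ
  IsPermutiple : List Pair → Set
  IsPermutiple s = InL s ×
    Σ[ σ ∈ Permutation′ (length s) ] (∀ j → proj₂ (lookup s j) ≡ proj₁ (lookup s (σ ⟨$⟩ʳ j)))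

  OrderableIntoPermutiple : List Pair → Set
  OrderableIntoPermutiple CI = ∃[ s ] (s ↭ CI × IsPermutiple s)

module Submission where

-- An edge (d₁ , d₂) of the mother graph induces exactly one transition, from state λ(x) to state
-- d₂ − ⌊x / b⌋ where x = d₁ + (b − n) d₂. So Δ_I is a multigraph on the states whose multiedges are
-- the elements of C_I, and the orderings of C_I lying in L are exactly the Euler circuits of Δ_I
-- through state 0. By Hierholzer's argument such a circuit exists iff Δ_I contains 0, is strongly
-- connected and balanced: balance lets a trail of unused edges be continued until it closes, and
-- connectivity lets each closed trail be spliced into the circuit built so far. The permutation σ
-- comes for free: along a cycle of M each digit occurs once as a first and once as a second
-- coordinate, so the second coordinates of C_I rearrange the first ones.

open import Defs
open import Data.Nat using (ℕ; zero; suc; _+_; _*_; _∸_; _<_; _≤_; NonZero)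
open import Data.Nat.Properties
  using (+-assoc; +-comm; +-cancelˡ-≡; +-cancelʳ-≡; *-cancelˡ-<; *-cancelʳ-≡; *-distribˡ-+; *-comm;
         *-suc; *-monoʳ-≤; +-monoʳ-<; m≤m+n; m≤n+m; n<1+n; ≤-pred; m∸n+n≡m; m+[n∸m]≡n; <⇒≤; <-trans;
         module ≤-Reasoning)
open import Data.Nat.DivMod using (_/_; _%_; _mod_; m≡m%n+[m/n]*n; [m+kn]%n≡m%n; m<n⇒m%n≡m; m<n*o⇒m/o<n)
open import Data.Nat.Induction using (<-wellFounded)
open import Data.Nat.Tactic.RingSolver using (solve-∀)
open import Data.Fin using (Fin; zero; suc; toℕ; cast)
open import Data.Fin.Properties
  using (toℕ-fromℕ<; toℕ-injective; toℕ<n; cast-involutive) renaming (_≟_ to _≟ᶠ_)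
open import Data.Fin.Permutation using (Permutation′; _⟨$⟩ʳ_; _∘ₚ_; cast-id)
open import Data.List using (List; []; _∷_; _++_; [_]; _∷ʳ_; map; zip; concatMap; length; filter; lookup)
open import Data.List.Properties
  using (length-++; length-map; filter-++; filter-accept; ++-identityʳ; map-++; ++-assoc)
open import Data.List.Membership.Propositional using (_∈_; _∉_)
open import Data.List.Membership.Propositional.Properties
  using (∈-++⁺ˡ; ∈-++⁺ʳ; ∈-++⁻; ∈-∃++; ∈-map⁺; ∈-map⁻)
open import Data.List.Relation.Unary.Any using (here; there; tail)
open import Data.List.Relation.Unary.All as All using (All; []; _∷_)
import Data.List.Relation.Unary.All.Properties as Allₚ
open import Data.List.Relation.Binary.Subset.Propositional using (_⊆_)
open import Data.List.Relation.Binary.Permutation.Propositional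
  using (_↭_; prep; swap; ↭-refl; ↭-sym; ↭-trans; ↭-reflexive; ↭⇒↭ₛ; module PermutationReasoning)
open import Data.List.Relation.Binary.Permutation.Propositional.Properties
  using (∈-resp-↭; All-resp-↭; ↭-length; ++⁺; ++⁺ˡ; ++⁺ʳ; shift; shifts; drop-∷; ∷↭∷ʳ; map⁺; filter-↭;
         ↭-empty-inv)
import Data.List.Relation.Binary.Permutation.Setoid as SetoidPerm
import Data.List.Relation.Binary.Permutation.Setoid.Properties as SetoidPermₚ
open import Data.Product using (_×_; _,_; map₂; proj₁; proj₂; ∃; ∃₂; Σ-syntax)
open import Data.Sum using (inj₁; inj₂)
open import Function using (_∘_; _on_)
open import Function.Bundles using (_⇔_; mk⇔; Equivalence)
open import Induction.WellFounded using (Acc; acc; WellFounded)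
import Relation.Binary.Construct.On as On
open import Relation.Binary.Core using (Rel)
open import Relation.Binary.Definitions using (DecidableEquality)
open import Relation.Binary.PropositionalEquality
  using (_≡_; refl; sym; trans; cong; subst; subst₂; setoid; module ≡-Reasoning)
open import Relation.Binary.Construct.Closure.ReflexiveTransitive using (Star; ε; _◅_; _◅◅_)
import Relation.Binary.Construct.Closure.ReflexiveTransitive as Star
open import Relation.Nullary using (¬_; yes; no; contradiction)
open import Relation.Unary using (Pred; Decidable)
open import Level using (0ℓ)

++-cancelˡ-↭ : ∀ {A : Set} (xs : List A) {ys zs} → xs ++ ys ↭ xs ++ zs → ys ↭ zs
++-cancelˡ-↭ []       p = p
++-cancelˡ-↭ (x ∷ xs) p = ++-cancelˡ-↭ xs (drop-∷ p)

++-cancel-↭ : ∀ {A : Set} {xs xs′ ys ys′ : List A} → xs ↭ xs′ → xs ++ ys ↭ xs′ ++ ys′ → ys ↭ ys′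
++-cancel-↭ {xs′ = xs′} {ys} xs↭xs′ p = ++-cancelˡ-↭ xs′ (↭-trans (++⁺ʳ ys (↭-sym xs↭xs′)) p)

∈⇒↭∷ : ∀ {A : Set} {x : A} {xs} → x ∈ xs → ∃ λ ys → xs ↭ x ∷ ys
∈⇒↭∷ x∈xs with ys , zs , refl ← ∈-∃++ x∈xs = ys ++ zs , shift _ ys zs

length-filter-map : ∀ {A B : Set} {P : Pred A 0ℓ} {Q : Pred B 0ℓ} (P? : Decidable P) (Q? : Decidable Q)
  (f : A → B) {xs} → All (λ x → P x ⇔ Q (f x)) xs →
  length (filter P? xs) ≡ length (filter Q? (map f xs))
length-filter-map P? Q? f {[]}     []            = refl
length-filter-map P? Q? f {x ∷ xs} (P⇔Q ∷ P⇔Qs) with P? x | Q? (f x)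
... | yes _  | yes _  = cong suc (length-filter-map P? Q? f P⇔Qs)
... | no _   | no _   = length-filter-map P? Q? f P⇔Qs
... | yes px | no ¬qx = contradiction (Equivalence.to P⇔Q px) ¬qx
... | no ¬px | yes qx = contradiction (Equivalence.from P⇔Q qx) ¬px

module Occurrences {V : Set} (_≟_ : DecidableEquality V) where

  open import Data.List.Membership.DecPropositional _≟_ using (_∈?_)

  count : V → List V → ℕ
  count v xs = length (filter (v ≟_) xs)

  count-++ : ∀ v xs ys → count v (xs ++ ys) ≡ count v xs + count v ys
  count-++ v xs ys = trans (cong length (filter-++ (v ≟_) xs ys)) (length-++ (filter (v ≟_) xs))

  count-↭ : ∀ v {xs ys} → xs ↭ ys → count v xs ≡ count v ys
  count-↭ v p = ↭-length (filter-↭ (v ≟_) p)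

  count-head : ∀ v xs → count v (v ∷ xs) ≡ suc (count v xs)
  count-head v xs = cong length (filter-accept (v ≟_) refl)

  count-∉ : ∀ {v xs} → v ∉ xs → count v xs ≡ 0
  count-∉ {xs = []}    _  = refl
  count-∉ {v} {x ∷ xs} v∉ with v ≟ x
  ... | yes refl = contradiction (here refl) v∉
  ... | no _     = count-∉ (v∉ ∘ there)

  count≗⇒↭ : ∀ xs {ys} → (∀ v → count v xs ≡ count v ys) → xs ↭ ys
  count≗⇒↭ []       {[]}     _  = ↭-refl
  count≗⇒↭ []       {y ∷ ys} eq with () ← trans (eq y) (count-head y ys)
  count≗⇒↭ (x ∷ xs) {ys}     eq with x ∈? ys
  ... | no x∉ys with () ← trans (sym (count-head x xs)) (trans (eq x) (count-∉ x∉ys))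
  ... | yes x∈ys with ys′ , ys↭x∷ys′ ← ∈⇒↭∷ x∈ys =
    ↭-trans (prep x (count≗⇒↭ xs λ v → +-cancelˡ-≡ (count v [ x ]) _ _ (begin
      count v [ x ] + count v xs  ≡⟨ count-++ v [ x ] xs ⟨
      count v (x ∷ xs)            ≡⟨ eq v ⟩
      count v ys                  ≡⟨ count-↭ v ys↭x∷ys′ ⟩
      count v (x ∷ ys′)           ≡⟨ count-++ v [ x ] ys′ ⟩
      count v [ x ] + count v ys′ ∎)))
      (↭-sym ys↭x∷ys′)
    where open ≡-Reasoning

Star-exit : ∀ {V : Set} {R : Rel V 0ℓ} {S : Pred V 0ℓ} → Decidable S → ∀ {x y} →
  Star R x y → S x → ¬ S y → ∃₂ λ u v → R u v × S u × ¬ S v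
Star-exit S? ε                   Sx ¬Sy = contradiction Sx ¬Sy
Star-exit S? (_◅_ {j = v} r rs) Sx ¬Sy with S? v
... | yes Sv  = Star-exit S? rs Sv ¬Sy
... | no  ¬Sv = _ , v , r , Sx , ¬Sv

module Multigraph {V A : Set} (_≟_ : DecidableEquality V) (src tgt : A → V) where

  open import Data.List.Membership.DecPropositional _≟_ using (_∈?_)

  sources targets endpoints : List A → List V
  sources   = map src
  targets   = map tgt
  endpoints E = sources E ++ targets E

  DegreeBalanced : List A → Set
  DegreeBalanced E = sources E ↭ targets E

  -- The balance of a trail from y to x; it is what remains of a degree-balanced multiset
  -- after removing a trail from x to y.
  PathBalanced : List A → V → V → Set
  PathBalanced R y x = x ∷ sources R ↭ y ∷ targets R

  Walk : V → List A → V → Set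
  Walk x []       y = x ≡ y
  Walk x (e ∷ es) y = src e ≡ x × Walk (tgt e) es y

  Adjacent : List A → V → V → Set
  Adjacent E x y = ∃ λ e → e ∈ E × src e ≡ x × tgt e ≡ y

  walk-++ : ∀ {x y z} w {w′} → Walk x w y → Walk y w′ z → Walk x (w ++ w′) z
  walk-++ []      refl       q = q
  walk-++ (e ∷ w) (refl , p) q = refl , walk-++ w p q

  walk-endpoints : ∀ {x y} w → Walk x w y → sources w ∷ʳ y ≡ x ∷ targets w
  walk-endpoints []      refl       = refl
  walk-endpoints (e ∷ w) (refl , p) = cong (src e ∷_) (walk-endpoints w p)

  closedWalk-balanced : ∀ {x} w → Walk x w x → DegreeBalanced w
  closedWalk-balanced {x} w p = drop-∷ (↭-trans (∷↭∷ʳ x (sources w)) (↭-reflexive (walk-endpoints w p)))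

  endpoints-↭ : ∀ {E E′} → E ↭ E′ → endpoints E ↭ endpoints E′
  endpoints-↭ p = ++⁺ (map⁺ src p) (map⁺ tgt p)

  endpoints⊆visited : ∀ {x y u} w → Walk x w y → u ∈ endpoints w → u ∈ x ∷ targets w
  endpoints⊆visited w p u∈ with ∈-++⁻ (sources w) u∈
  ... | inj₁ u∈s = subst (_ ∈_) (walk-endpoints w p) (∈-++⁺ˡ u∈s)
  ... | inj₂ u∈t = there u∈t

  walk-split : ∀ {x y u} w → Walk x w y → u ∈ x ∷ targets w →
               ∃₂ λ w₁ w₂ → w ≡ w₁ ++ w₂ × Walk x w₁ u × Walk u w₂ y
  walk-split w       p          (here refl) = [] , w , refl , refl , p
  walk-split (e ∷ w) (refl , p) (there u∈)
    with w₁ , w₂ , refl , p₁ , p₂ ← walk-split w p u∈ = e ∷ w₁ , w₂ , refl , (refl , p₁) , p₂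

  walk⇒star : ∀ {E x y} w → Walk x w y → w ⊆ E → Star (Adjacent E) x y
  walk⇒star []      refl       _   = ε
  walk⇒star (e ∷ w) (refl , p) w⊆E = (e , w⊆E (here refl) , refl , refl) ◅ walk⇒star w p (w⊆E ∘ there)

  walk-through : ∀ {E x y u} w → Walk x w y → w ⊆ E → u ∈ x ∷ targets w →
                 Star (Adjacent E) x u × Star (Adjacent E) u y
  walk-through w p w⊆E u∈ with w₁ , w₂ , refl , p₁ , p₂ ← walk-split w p u∈ =
    walk⇒star w₁ p₁ (w⊆E ∘ ∈-++⁺ˡ) , walk⇒star w₂ p₂ (w⊆E ∘ ∈-++⁺ʳ w₁)

  _⊰_ : Rel (List A) 0ℓ
  _⊰_ = _<_ on length

  ⊰-wellFounded : WellFounded _⊰_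
  ⊰-wellFounded = On.wellFounded length <-wellFounded

  ↭-drop⊰ : ∀ {e R′ R} C → e ∷ C ++ R′ ↭ R → R′ ⊰ R
  ↭-drop⊰ {e} {R′} {R} C p = begin-strict
    length R′             ≤⟨ m≤n+m (length R′) (length C) ⟩
    length C + length R′  ≡⟨ length-++ C ⟨
    length (C ++ R′)      <⟨ n<1+n _ ⟩
    length (e ∷ C ++ R′)  ≡⟨ ↭-length p ⟩
    length R              ∎
    where open ≤-Reasoning

  PathBalanced-remove : ∀ {R R₀ e x} → R ↭ e ∷ R₀ → PathBalanced R (src e) x → PathBalanced R₀ (tgt e) x
  PathBalanced-remove {R} {R₀} {e} {x} R↭ bal = drop-∷ (begin
    src e ∷ x ∷ sources R₀   ↭⟨ swap (src e) x ↭-refl ⟩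
    x ∷ sources (e ∷ R₀)     ↭⟨ prep x (map⁺ src (↭-sym R↭)) ⟩
    x ∷ sources R            ↭⟨ bal ⟩
    src e ∷ targets R        ↭⟨ prep (src e) (map⁺ tgt R↭) ⟩
    src e ∷ tgt e ∷ targets R₀ ∎)
    where open PermutationReasoning

  -- Greedy trail: while y ≠ x, path balance forces an unused edge out of y.
  mutual
    trailTo : ∀ {R x y} → Acc _⊰_ R → PathBalanced R y x →
              ∃₂ λ T R′ → Walk y T x × T ++ R′ ↭ R
    trailTo {R} {x} {y} rec bal with y ≟ x
    ... | yes refl = [] , R , refl , ↭-refl
    ... | no y≢x with e , e∈R , refl ← ∈-map⁻ src (tail y≢x (∈-resp-↭ (↭-sym bal) (here refl)))
      with T , R′ , w , p ← trailTo-via e rec e∈R bal = e ∷ T , R′ , w , p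

    trailTo-via : ∀ {R x} e → Acc _⊰_ R → e ∈ R → PathBalanced R (src e) x →
                  ∃₂ λ T R′ → Walk (src e) (e ∷ T) x × e ∷ T ++ R′ ↭ R
    trailTo-via e (acc rec) e∈R bal
      with R₀ , R↭ ← ∈⇒↭∷ e∈R
      with T , R′ , w , p ← trailTo (rec (↭-drop⊰ [] (↭-sym R↭))) (PathBalanced-remove R↭ bal)
      = T , R′ , (refl , w) , ↭-trans (prep e p) (↭-sym R↭)

  leavingEdge-unused : ∀ {W R E e x} → W ++ R ↭ E → e ∈ E → tgt e ∉ x ∷ targets W → e ∈ R
  leavingEdge-unused {W} W++R↭E e∈E t∉ with ∈-++⁻ W (∈-resp-↭ (↭-sym W++R↭E) e∈E)
  ... | inj₁ e∈W = contradiction (there (∈-map⁺ tgt e∈W)) t∉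
  ... | inj₂ e∈R = e∈R

  DegreeBalanced-++⁻ : ∀ {C R′ R} → DegreeBalanced C → C ++ R′ ↭ R → DegreeBalanced R → DegreeBalanced R′
  DegreeBalanced-++⁻ {C} {R′} {R} balC p balR = ++-cancel-↭ balC (begin
    sources C ++ sources R′  ≡⟨ map-++ src C R′ ⟨
    sources (C ++ R′)        ↭⟨ map⁺ src p ⟩
    sources R                ↭⟨ balR ⟩
    targets R                ↭⟨ map⁺ tgt (↭-sym p) ⟩
    targets (C ++ R′)        ≡⟨ map-++ tgt C R′ ⟩
    targets C ++ targets R′  ∎)
    where open PermutationReasoning

  insert-↭ : ∀ W₁ W₂ C {R′ R : List A} → C ++ R′ ↭ R → (W₁ ++ C ++ W₂) ++ R′ ↭ (W₁ ++ W₂) ++ R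
  insert-↭ W₁ W₂ C {R′} {R} p = begin
    (W₁ ++ C ++ W₂) ++ R′  ≡⟨ ++-assoc W₁ (C ++ W₂) R′ ⟩
    W₁ ++ (C ++ W₂) ++ R′  ≡⟨ cong (W₁ ++_) (++-assoc C W₂ R′) ⟩
    W₁ ++ C ++ W₂ ++ R′    ↭⟨ ++⁺ˡ W₁ (shifts C W₂) ⟩
    W₁ ++ W₂ ++ C ++ R′    ↭⟨ ++⁺ˡ W₁ (++⁺ˡ W₂ p) ⟩
    W₁ ++ W₂ ++ R          ≡⟨ ++-assoc W₁ W₂ R ⟨
    (W₁ ++ W₂) ++ R        ∎
    where open PermutationReasoning

  -- Hierholzer: splice closed trails of unused edges into the circuit W until no edge is left.
  module _ (E : List A) (z : V) (reachable : ∀ {e} → e ∈ E → Star (Adjacent E) z (src e)) where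

    unusedEdgeAtVisited : ∀ {W R e₀} → W ++ R ↭ E → e₀ ∈ R →
                          ∃ λ e → e ∈ R × src e ∈ z ∷ targets W
    unusedEdgeAtVisited {W} {e₀ = e₀} W++R↭E e₀∈R with src e₀ ∈? z ∷ targets W
    ... | yes s∈ = e₀ , e₀∈R , s∈
    ... | no s∉
      with _ , _ , (e , e∈E , refl , refl) , s∈ , t∉ ←
           Star-exit (_∈? z ∷ targets W) (reachable (∈-resp-↭ W++R↭E (∈-++⁺ʳ W e₀∈R))) (here refl) s∉
      = e , leavingEdge-unused W++R↭E e∈E t∉ , s∈

    splice : ∀ W {R} → Acc _⊰_ R → Walk z W z → W ++ R ↭ E → DegreeBalanced R →
             ∃ λ s → s ↭ E × Walk z s z
    splice W {[]}    _         w W↭E _ = W , ↭-trans (↭-reflexive (sym (++-identityʳ W))) W↭E , w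
    splice W {_ ∷ _} (acc rec) w W++R↭E balR
      with e , e∈R , s∈ ← unusedEdgeAtVisited W++R↭E (here refl)
      with W₁ , W₂ , refl , w₁ , w₂ ← walk-split W w s∈
      with C , R′ , c , C++R′↭R ← trailTo-via e (⊰-wellFounded _) e∈R (prep (src e) balR)
      = splice (W₁ ++ (e ∷ C) ++ W₂) (rec (↭-drop⊰ C C++R′↭R))
          (walk-++ W₁ w₁ (walk-++ (e ∷ C) c w₂))
          (↭-trans (insert-↭ W₁ W₂ (e ∷ C) C++R′↭R) W++R↭E)
          (DegreeBalanced-++⁻ (closedWalk-balanced (e ∷ C) c) C++R′↭R balR)

    eulerCircuit : DegreeBalanced E → ∃ λ s → s ↭ E × Walk z s z
    eulerCircuit = splice [] (⊰-wellFounded E) refl ↭-refl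

divMod-unique : ∀ {b} .{{_ : NonZero b}} {q q′ r r′} → r < b → r′ < b →
                r + q * b ≡ r′ + q′ * b → r ≡ r′ × q ≡ q′
divMod-unique {b} {q} {q′} {r} {r′} r<b r′<b eq =
  r≡r′ , *-cancelʳ-≡ q q′ b (+-cancelˡ-≡ r _ _ (trans eq (cong (_+ q′ * b) (sym r≡r′))))
  where
  r≡r′ : r ≡ r′
  r≡r′ = begin
    r                 ≡⟨ m<n⇒m%n≡m r<b ⟨
    r % b             ≡⟨ [m+kn]%n≡m%n r q b ⟨
    (r + q * b) % b   ≡⟨ cong (_% b) eq ⟩
    (r′ + q′ * b) % b ≡⟨ [m+kn]%n≡m%n r′ q′ b ⟩
    r′ % b            ≡⟨ m<n⇒m%n≡m r′<b ⟩
    r′                ∎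
    where open ≡-Reasoning

module Transition (b n : ℕ) .{{_ : NonZero b}} where

  Transition : Pair → ℕ → ℕ → Set
  Transition (d₁ , d₂) c₁ c₂ = b * c₂ + d₁ ≡ n * d₂ + c₁

  transition-unique : ∀ {e c₁ c₂ c₁′ c₂′} → c₁ < b → c₁′ < b →
                      Transition e c₁ c₂ → Transition e c₁′ c₂′ → c₁ ≡ c₁′ × c₂ ≡ c₂′
  transition-unique {d₁ , d₂} {c₁} {c₂} {c₁′} {c₂′} c₁<b c₁′<b t t′ =
    map₂ sym (divMod-unique c₁<b c₁′<b (+-cancelʳ-≡ d₁ _ _ (begin
      c₁ + c₂′ * b + d₁    ≡⟨ shuffle c₁ c₂′ b d₁ ⟩
      c₁ + (b * c₂′ + d₁)  ≡⟨ cong (c₁ +_) t′ ⟩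
      c₁ + (n * d₂ + c₁′)  ≡⟨ swapEnds c₁ (n * d₂) c₁′ ⟩
      c₁′ + (n * d₂ + c₁)  ≡⟨ cong (c₁′ +_) t ⟨
      c₁′ + (b * c₂ + d₁)  ≡⟨ shuffle c₁′ c₂ b d₁ ⟨
      c₁′ + c₂ * b + d₁    ∎)))
    where
    open ≡-Reasoning
    shuffle : ∀ c q b d → c + q * b + d ≡ c + (b * q + d)
    shuffle = solve-∀
    swapEnds : ∀ c m c′ → c + (m + c′) ≡ c′ + (m + c)
    swapEnds = solve-∀

  transition-bound : ∀ {d₁ d₂ c₁ c₂} → d₂ < b → c₁ < n → Transition (d₁ , d₂) c₁ c₂ → c₂ < n
  transition-bound {d₁} {d₂} {c₁} {c₂} d₂<b c₁<n t = *-cancelˡ-< b c₂ n (begin-strict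
    b * c₂       ≤⟨ m≤m+n (b * c₂) d₁ ⟩
    b * c₂ + d₁  ≡⟨ t ⟩
    n * d₂ + c₁  <⟨ +-monoʳ-< (n * d₂) c₁<n ⟩
    n * d₂ + n   ≡⟨ trans (+-comm (n * d₂) n) (sym (*-suc n d₂)) ⟩
    n * suc d₂   ≤⟨ *-monoʳ-≤ n d₂<b ⟩
    n * b        ≡⟨ *-comm n b ⟩
    b * n        ∎)
    where open ≤-Reasoning

  shifted : Pair → ℕ
  shifted (d₁ , d₂) = d₁ + (b ∸ n) * d₂

  fromState toState : Pair → ℕ
  fromState e         = shifted e % b
  toState   (d₁ , d₂) = d₂ ∸ shifted (d₁ , d₂) / b

  module _ (n≤b : n ≤ b) where

    shifted-identity : ∀ d₁ d₂ → n * d₂ + shifted (d₁ , d₂) ≡ b * d₂ + d₁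
    shifted-identity d₁ d₂ = trans (regroup n (b ∸ n) d₁ d₂) (cong (λ m → m * d₂ + d₁) (m+[n∸m]≡n n≤b))
      where
      regroup : ∀ n m d₁ d₂ → n * d₂ + (d₁ + m * d₂) ≡ (n + m) * d₂ + d₁
      regroup = solve-∀

    shifted/b≤d₂ : ∀ {d₁ d₂} → d₁ < b → shifted (d₁ , d₂) / b ≤ d₂
    shifted/b≤d₂ {d₁} {d₂} d₁<b = ≤-pred (m<n*o⇒m/o<n (begin-strict
      shifted (d₁ , d₂)           ≤⟨ m≤n+m _ (n * d₂) ⟩
      n * d₂ + shifted (d₁ , d₂)  ≡⟨ shifted-identity d₁ d₂ ⟩
      b * d₂ + d₁                 <⟨ +-monoʳ-< (b * d₂) d₁<b ⟩
      b * d₂ + b                  ≡⟨ trans (+-comm (b * d₂) b) (cong (b +_) (*-comm b d₂)) ⟩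
      suc d₂ * b                  ∎))
      where open ≤-Reasoning

    transition-solution : ∀ {d₁ d₂} → d₁ < b →
                          Transition (d₁ , d₂) (fromState (d₁ , d₂)) (toState (d₁ , d₂))
    transition-solution {d₁} {d₂} d₁<b = +-cancelʳ-≡ (q * b) _ _ (begin
      b * (d₂ ∸ q) + d₁ + q * b   ≡⟨ regroup (b * (d₂ ∸ q)) d₁ q b ⟩
      (b * (d₂ ∸ q) + b * q) + d₁ ≡⟨ cong (_+ d₁) (*-distribˡ-+ b (d₂ ∸ q) q) ⟨
      b * (d₂ ∸ q + q) + d₁       ≡⟨ cong (λ m → b * m + d₁) (m∸n+n≡m q≤d₂) ⟩
      b * d₂ + d₁                 ≡⟨ shifted-identity d₁ d₂ ⟨
      n * d₂ + x                  ≡⟨ cong (n * d₂ +_) (m≡m%n+[m/n]*n x b) ⟩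
      n * d₂ + (x % b + q * b)    ≡⟨ +-assoc (n * d₂) (x % b) (q * b) ⟨
      n * d₂ + x % b + q * b      ∎)
      where
      open ≡-Reasoning
      x = shifted (d₁ , d₂)
      q = x / b
      q≤d₂ : q ≤ d₂
      q≤d₂ = shifted/b≤d₂ d₁<b
      regroup : ∀ a d q b → a + d + q * b ≡ (a + b * q) + d
      regroup = solve-∀

lookup-map : ∀ {A B : Set} (f : A → B) (xs : List A) (i : Fin (length (map f xs))) →
             lookup (map f xs) i ≡ f (lookup xs (cast (length-map f xs) i))
lookup-map f (x ∷ xs) zero    = refl
lookup-map f (x ∷ xs) (suc i) = lookup-map f xs i

map↭map⇒indexPermutation : ∀ {A B : Set} (f g : A → B) (xs : List A) → map f xs ↭ map g xs →
  Σ[ σ ∈ Permutation′ (length xs) ] (∀ i → f (lookup xs i) ≡ g (lookup xs (σ ⟨$⟩ʳ i)))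
map↭map⇒indexPermutation {B = B} f g xs p = σ , lookup-σ
  where
  open ≡-Reasoning
  π = SetoidPerm.onIndices (↭⇒↭ₛ p)
  |f| = length-map f xs
  σ : Permutation′ (length xs)
  σ = (cast-id (sym |f|) ∘ₚ π) ∘ₚ cast-id (length-map g xs)
  lookup-σ : ∀ i → f (lookup xs i) ≡ g (lookup xs (σ ⟨$⟩ʳ i))
  lookup-σ i = begin
    f (lookup xs i)                              ≡⟨ cong (f ∘ lookup xs) (cast-involutive |f| (sym |f|) i) ⟨
    f (lookup xs (cast |f| (cast (sym |f|) i)))  ≡⟨ lookup-map f xs (cast (sym |f|) i) ⟨
    lookup (map f xs) (cast (sym |f|) i)         ≡⟨ SetoidPermₚ.onIndices-lookup (setoid B) (↭⇒↭ₛ p) _ ⟩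
    lookup (map g xs) (π ⟨$⟩ʳ cast (sym |f|) i)  ≡⟨ lookup-map g xs _ ⟩
    g (lookup xs (σ ⟨$⟩ʳ i))                     ∎

cycleEdges-rotation : ∀ vs → map proj₂ (cycleEdges vs) ↭ map proj₁ (cycleEdges vs)
cycleEdges-rotation []       = ↭-refl
cycleEdges-rotation (v ∷ vs) = begin
  map proj₂ (zip (v ∷ vs) (vs ∷ʳ v)) ≡⟨ seconds v vs ⟩
  vs ∷ʳ v                           ↭⟨ ∷↭∷ʳ v vs ⟨
  v ∷ vs                            ≡⟨ firsts v vs ⟨
  map proj₁ (zip (v ∷ vs) (vs ∷ʳ v)) ∎
  where
  open PermutationReasoning
  firsts : ∀ (u : ℕ) us → map proj₁ (zip (u ∷ us) (us ∷ʳ v)) ≡ u ∷ us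
  firsts u []       = refl
  firsts u (w ∷ ws) = cong (u ∷_) (firsts w ws)
  seconds : ∀ (u : ℕ) us → map proj₂ (zip (u ∷ us) (us ∷ʳ v)) ≡ us ∷ʳ v
  seconds u []       = refl
  seconds u (w ∷ ws) = cong (w ∷_) (seconds w ws)

concatMap-cycleEdges-rotation : ∀ cs →
  map proj₂ (concatMap cycleEdges cs) ↭ map proj₁ (concatMap cycleEdges cs)
concatMap-cycleEdges-rotation []       = ↭-refl
concatMap-cycleEdges-rotation (c ∷ cs) = begin
  map proj₂ (cycleEdges c ++ concatMap cycleEdges cs)
    ≡⟨ map-++ proj₂ (cycleEdges c) _ ⟩
  map proj₂ (cycleEdges c) ++ map proj₂ (concatMap cycleEdges cs)
    ↭⟨ ++⁺ (cycleEdges-rotation c) (concatMap-cycleEdges-rotation cs) ⟩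
  map proj₁ (cycleEdges c) ++ map proj₁ (concatMap cycleEdges cs)
    ≡⟨ map-++ proj₁ (cycleEdges c) _ ⟨
  map proj₁ (cycleEdges c ++ concatMap cycleEdges cs)
    ∎
  where open PermutationReasoning

module HoeySloane (b n′ : ℕ) .{{_ : NonZero b}} (n<b : suc n′ < b) where

  private
    n : ℕ
    n = suc n′

  open Transition b n
  open Occurrences (_≟ᶠ_ {n})

  toℕ-mod : ∀ {m} → m < n → toℕ (m mod n) ≡ m
  toℕ-mod m<n = trans (toℕ-fromℕ< _) (m<n⇒m%n≡m m<n)

  -- Reducing mod n only makes these total (on edges of M the states are already below n);
  -- opacity stops the unifier from unfolding the arithmetic.
  opaque
    source target : Pair → Fin n
    source e = fromState e mod n
    target e = toState e mod n

    edge-induces : ∀ {e} → IsEdgeM b n e → Induces b n e (source e) (target e)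
    edge-induces {d₁ , d₂} (d₁<b , d₂<b , λ<n) =
      subst₂ (Transition (d₁ , d₂)) (sym (toℕ-mod λ<n)) (sym (toℕ-mod (transition-bound d₂<b λ<n t))) t
      where
      t : Transition (d₁ , d₂) (fromState (d₁ , d₂)) (toState (d₁ , d₂))
      t = transition-solution (<⇒≤ n<b) d₁<b

  open Multigraph _≟ᶠ_ source target

  induces-unique : ∀ {e c₁ c₂} → IsEdgeM b n e → Induces b n e c₁ c₂ → c₁ ≡ source e × c₂ ≡ target e
  induces-unique {e} {c₁} isEdge ind
    with c₁≡ , c₂≡ ← transition-unique (<-trans (toℕ<n c₁) n<b) (<-trans (toℕ<n (source e)) n<b)
                                       ind (edge-induces isEdge)
    = toℕ-injective c₁≡ , toℕ-injective c₂≡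

  leaves⇔source : ∀ {e c} → IsEdgeM b n e → (∃ λ c₂ → Induces b n e c c₂) ⇔ c ≡ source e
  leaves⇔source {e} isEdge = mk⇔ (λ (_ , ind) → proj₁ (induces-unique isEdge ind))
    (λ c≡ → target e , subst (λ c → Induces b n e c (target e)) (sym c≡) (edge-induces isEdge))

  enters⇔target : ∀ {e c} → IsEdgeM b n e → (∃ λ c₁ → Induces b n e c₁ c) ⇔ c ≡ target e
  enters⇔target {e} isEdge = mk⇔ (λ (_ , ind) → proj₂ (induces-unique isEdge ind))
    (λ c≡ → source e , subst (Induces b n e (source e)) (sym c≡) (edge-induces isEdge))

  run⇒walk : ∀ {c s} → All (IsEdgeM b n) s → Run b n c s → Walk c s zero
  run⇒walk {s = []}    []               c≡0              = toℕ-injective c≡0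
  run⇒walk {s = e ∷ s} (isEdge ∷ edges) (_ , ind , run)
    with refl , refl ← induces-unique isEdge ind = refl , run⇒walk edges run

  walk⇒run : ∀ {c s} → All (IsEdgeM b n) s → Walk c s zero → Run b n c s
  walk⇒run {s = []}    []               refl       = refl
  walk⇒run {s = e ∷ s} (isEdge ∷ edges) (refl , w) = target e , edge-induces isEdge , walk⇒run edges w

  cycles-edges : ∀ cs → All (IsCycleM b n) cs → All (IsEdgeM b n) (concatMap cycleEdges cs)
  cycles-edges []              []                        = []
  cycles-edges ((_ ∷ _) ∷ cs) ((_ , _ , edges) ∷ cycles) = Allₚ.++⁺ edges (cycles-edges cs cycles)

  module _ {CI : List Pair} (edges : All (IsEdgeM b n) CI) where

    step⇒adjacent : ∀ {c₁ c₂} → Step b n CI c₁ c₂ → Adjacent CI c₁ c₂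
    step⇒adjacent (e , e∈ , ind)
      with refl , refl ← induces-unique (All.lookup edges e∈) ind = e , e∈ , refl , refl

    adjacent⇒step : ∀ {c₁ c₂} → Adjacent CI c₁ c₂ → Step b n CI c₁ c₂
    adjacent⇒step (e , e∈ , refl , refl) = e , e∈ , edge-induces (All.lookup edges e∈)

    isVertex⇔∈endpoints : ∀ {c} → IsVertex b n CI c ⇔ c ∈ endpoints CI
    isVertex⇔∈endpoints = mk⇔ vertex⇒endpoint endpoint⇒vertex
      where
      vertex⇒endpoint : ∀ {c} → IsVertex b n CI c → c ∈ endpoints CI
      vertex⇒endpoint (_ , inj₁ step)
        with e , e∈ , refl , _ ← step⇒adjacent step = ∈-++⁺ˡ (∈-map⁺ source e∈)
      vertex⇒endpoint (_ , inj₂ step)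
        with e , e∈ , _ , refl ← step⇒adjacent step = ∈-++⁺ʳ (sources CI) (∈-map⁺ target e∈)
      endpoint⇒vertex : ∀ {c} → c ∈ endpoints CI → IsVertex b n CI c
      endpoint⇒vertex c∈ with ∈-++⁻ (sources CI) c∈
      ... | inj₁ c∈s with e , e∈ , refl ← ∈-map⁻ source c∈s =
        target e , inj₁ (adjacent⇒step (e , e∈ , refl , refl))
      ... | inj₂ c∈t with e , e∈ , refl ← ∈-map⁻ target c∈t =
        source e , inj₂ (adjacent⇒step (e , e∈ , refl , refl))

    source-isVertex : ∀ {e} → e ∈ CI → IsVertex b n CI (source e)
    source-isVertex e∈ = Equivalence.from isVertex⇔∈endpoints (∈-++⁺ˡ (∈-map⁺ source e∈))

    outdeg≡count : ∀ c → outdeg b n CI c ≡ count c (sources CI)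
    outdeg≡count c = length-filter-map _ (c ≟ᶠ_) source (All.map leaves⇔source edges)

    indeg≡count : ∀ c → indeg b n CI c ≡ count c (targets CI)
    indeg≡count c = length-filter-map _ (c ≟ᶠ_) target (All.map enters⇔target edges)

    degreeBalanced⇔balanced : DegreeBalanced CI ⇔ Balanced b n CI
    degreeBalanced⇔balanced = mk⇔
      (λ bal c _ → trans (indeg≡count c) (trans (count-↭ c (↭-sym bal)) (sym (outdeg≡count c))))
      (λ bal → count≗⇒↭ (sources CI) (λ c → balancedAt bal c))
      where
      open import Data.List.Membership.DecPropositional _≟ᶠ_ using (_∈?_)
      balancedAt : Balanced b n CI → ∀ c → count c (sources CI) ≡ count c (targets CI)
      balancedAt bal c with c ∈? endpoints CI
      ... | yes c∈ = trans (sym (outdeg≡count c))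
                       (trans (sym (bal c (Equivalence.from isVertex⇔∈endpoints c∈))) (indeg≡count c))
      ... | no c∉  = trans (count-∉ {xs = sources CI} (c∉ ∘ ∈-++⁺ˡ))
                       (sym (count-∉ {xs = targets CI} (c∉ ∘ ∈-++⁺ʳ (sources CI))))

    reachableFrom : ∀ {c} → StronglyConnected b n CI → IsVertex b n CI c →
                    ∀ {e} → e ∈ CI → Star (Adjacent CI) c (source e)
    reachableFrom connected c-vertex e∈ = Star.map step⇒adjacent (connected _ _ c-vertex (source-isVertex e∈))

  module _ (cs : List (List ℕ)) (cycles : All (IsCycleM b n) cs) where

    private
      CI : List Pair
      CI = concatMap cycleEdges cs

      CI-edges : All (IsEdgeM b n) CI
      CI-edges = cycles-edges cs cycles

    EulerCircuit : Set
    EulerCircuit = ∃₂ λ e s → e ∷ s ↭ CI × Walk zero (e ∷ s) zero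

    permutiple⇒circuit : OrderableIntoPermutiple b n CI → EulerCircuit
    permutiple⇒circuit (e ∷ s , p , (edges , c₀ , c₀≡0 , run) , _)
      with refl ← toℕ-injective {j = zero} c₀≡0 = e , s , p , run⇒walk edges run

    circuit⇒permutiple : EulerCircuit → OrderableIntoPermutiple b n CI
    circuit⇒permutiple (e , s , p , w) =
      e ∷ s , p , (edges , zero , refl , walk⇒run edges w) ,
      map↭map⇒indexPermutation proj₂ proj₁ (e ∷ s) digits
      where
      edges : All (IsEdgeM b n) (e ∷ s)
      edges = All-resp-↭ (↭-sym p) CI-edges
      digits : map proj₂ (e ∷ s) ↭ map proj₁ (e ∷ s)
      digits = ↭-trans (map⁺ proj₂ p) (↭-trans (concatMap-cycleEdges-rotation cs) (↭-sym (map⁺ proj₁ p)))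

    circuit⇒conditions : EulerCircuit → ContainsState0 b n CI × StronglyConnected b n CI × Balanced b n CI
    circuit⇒conditions (e , s , p , w) = state0 , connected , balanced
      where
      s⊆CI : e ∷ s ⊆ CI
      s⊆CI = ∈-resp-↭ p

      through : ∀ {u} → IsVertex b n CI u → Star (Adjacent CI) zero u × Star (Adjacent CI) u zero
      through u-vertex = walk-through (e ∷ s) w s⊆CI (endpoints⊆visited (e ∷ s) w
        (∈-resp-↭ (endpoints-↭ (↭-sym p)) (Equivalence.to (isVertex⇔∈endpoints CI-edges) u-vertex)))

      state0 : ContainsState0 b n CI
      state0 = zero , refl , subst (IsVertex b n CI) (proj₁ w) (source-isVertex CI-edges (s⊆CI (here refl)))

      connected : StronglyConnected b n CI
      connected _ _ u-vertex v-vertex =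
        Star.map (adjacent⇒step CI-edges) (proj₂ (through u-vertex) ◅◅ proj₁ (through v-vertex))

      balanced : Balanced b n CI
      balanced = Equivalence.to (degreeBalanced⇔balanced CI-edges) (begin
        sources CI       ↭⟨ map⁺ source (↭-sym p) ⟩
        sources (e ∷ s)  ↭⟨ closedWalk-balanced (e ∷ s) w ⟩
        targets (e ∷ s)  ↭⟨ map⁺ target p ⟩
        targets CI       ∎)
        where open PermutationReasoning

    conditions⇒circuit : ContainsState0 b n CI × StronglyConnected b n CI × Balanced b n CI → EulerCircuit
    conditions⇒circuit ((c₀ , c₀≡0 , c₀-vertex) , connected , balanced)
      with refl ← toℕ-injective {j = zero} c₀≡0
      with eulerCircuit CI zero (reachableFrom CI-edges connected c₀-vertex)
             (Equivalence.from (degreeBalanced⇔balanced CI-edges) balanced)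
    ... | e ∷ s , p , w = e , s , p , w
    ... | []    , p , _ with () ← subst (λ E → zero ∈ endpoints E) (↭-empty-inv (↭-sym p))
                                    (Equivalence.to (isVertex⇔∈endpoints CI-edges) c₀-vertex)

corollary4p3 : (b n : ℕ) .{{_ : NonZero b}} → 1 < n → n < b →
    (cs : List (List ℕ)) → All (IsCycleM b n) cs →
    OrderableIntoPermutiple b n (concatMap cycleEdges cs) ⇔
      (ContainsState0 b n (concatMap cycleEdges cs) ×
       StronglyConnected b n (concatMap cycleEdges cs) ×
       Balanced b n (concatMap cycleEdges cs))
corollary4p3 b (suc n′) _ n<b cs cycles =
  mk⇔ (circuit⇒conditions cs cycles ∘ permutiple⇒circuit cs cycles)
      (circuit⇒permutiple cs cycles ∘ conditions⇒circuit cs cycles)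
  where open HoeySloane b n′ n<b
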